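{- Every sparsely totient number other than $2$ is divisible by $3$; equivalently, $3\mid N_1(m)$ for every $m\in V$ with $m>1$.
   Context: $\phi$ is Euler's totient function, $V$ its image; for $m\in V$, $N_1(m)=\max\{x\in\mathbb{N}:\phi(x)\le m\}$, and the sparsely totient numbers are the elements of $N_1=\{N_1(m):m\in V\}$. -}

module Defs where

open import Data.Nat using (ℕ; zero; suc; _≤_; _<_; _≟_)
open import Data.Nat.GCD using (gcd)
open import Data.List using (List; length; filter; upTo; map)
open import Data.Product using (_×_; ∃-syntax)
open import Relation.Binary.PropositionalEquality using (_≡_)

-- Euler's totient: φ n = #{ k : 1 ≤ k ≤ n , gcd k n = 1 }  (so φ 0 = 0, φ 1 = 1)
φ : ℕ → ℕ
φ n = length (filter (λ k → gcd k n ≟ 1) (map suc (upTo n)))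

InV : ℕ → Set
InV m = ∃[ x ] (1 ≤ x × φ x ≡ m)

IsN₁ : ℕ → ℕ → Set
IsN₁ m N = 1 ≤ N × φ N ≤ m × (∀ x → 1 ≤ x → φ x ≤ m → x ≤ N)

-- Let N = N₁(m) with 3 ∤ N. By maximality no x > N has φ x ≤ φ N. If N is odd,
-- x = 2N has the same totient; if N = 2k with k even, so does x = 3k, since
-- φ(3k) = 2φ(k) = φ(2k). So N = 2k with k coprime to 6, and k = 1 is excluded because
-- φ 6 = 2 ≤ m. Otherwise write k = ps with p prime, p ≥ 5, and pick y = 2ᵃ3ᵇ with
-- 2p < y ≤ 3(p − 1): such a y exists for small p by inspection and for larger p by
-- doubling the one for ⌊p/2⌋. Then x = ys exceeds N while
-- φ(ys) = yφ(s)/3 ≤ (p − 1)φ(s) ≤ φ(ps) = φ(N).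
--
-- The identities for φ(pn), p prime, come from counting the integers of [1, pn]
-- coprime to n (an n-periodic condition) according to whether p divides them.

module Submission where

open import Defs
open import Level using (Level)
open import Data.Bool using (Bool; true; false; _∧_; not)
open import Data.Bool.Properties using (∧-identityʳ)
open import Data.Nat using (ℕ; zero; suc; _+_; _*_; _≤_; _<_; _≟_; _≤?_; _<?_; z≤n; s≤s; z<s; NonZero; >-nonZero; >-nonZero⁻¹; ⌊_/2⌋)
open import Data.Nat.Properties
open import Algebra.Properties.CommutativeSemigroup +-commutativeSemigroup using () renaming (interchange to +-interchange)
open import Algebra.Properties.CommutativeSemigroup *-commutativeSemigroup using () renaming (x∙yz≈y∙xz to x*[y*z]≡y*[x*z])
open import Data.Nat.Induction using (<-rec)
open import Data.Nat.Divisibility using (_∣_; _∣?_; divides; ∣-refl; ∣-trans; m∣m*n; n∣m*n; ∣m∣n⇒∣m+n; ∣m+n∣m⇒∣n; ∣⇒≤)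
open import Data.Nat.GCD using (gcd)
open import Data.Nat.Coprimality using (Coprime; coprime?; coprime-+; coprime-divisor; gcd≡1⇒coprime; coprime⇒gcd≡1) renaming (sym to coprime-sym)
open import Data.Nat.Primality using (Prime; prime[2]; prime?; prime⇒irreducible; prime⇒nonZero; ¬prime[0]; ¬prime[1]; euclidsLemma)
open import Data.Nat.Primality.Factorisation using (factorise)
open import Data.Nat.ListAction using (product)
open import Data.List using ([]; _∷_; _++_; [_]; length; filter; upTo; map)
open import Data.List.Properties using (upTo-∷ʳ; map-++; length-++; filter-++)
open import Data.List.Relation.Unary.All using (_∷_)
open import Data.Product using (_×_; _,_; proj₂; ∃-syntax)
open import Data.Sum using (inj₁; inj₂)
open import Function using (_∘_; flip; _⇔_; mk⇔)
open import Function.Properties.Equivalence using () renaming (sym to ⇔-sym)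
open import Relation.Unary using (Pred; Decidable)
open import Relation.Unary.Properties using (_∩?_; ∁?)
open import Relation.Nullary using (¬_; yes; no; does; contradiction)
open import Relation.Nullary.Decidable using (dec-true; dec-false; does-⇔; from-yes; from-no)
open import Relation.Binary.PropositionalEquality using (_≡_; _≢_; refl; sym; trans; cong; cong₂; subst; module ≡-Reasoning)

private
  variable
    ℓ ℓ′ : Level
    P : Pred ℕ ℓ
    Q : Pred ℕ ℓ′

𝟙 : Bool → ℕ
𝟙 true  = 1
𝟙 false = 0

count : Decidable P → ℕ → ℕ
count P? zero    = 0
count P? (suc n) = count P? n + 𝟙 (does (P? (suc n)))

length-filter-[x] : (P? : Decidable P) → ∀ x → length (filter P? [ x ]) ≡ 𝟙 (does (P? x))
length-filter-[x] P? x with does (P? x)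
... | true  = refl
... | false = refl

length-filter≡count : (P? : Decidable P) → ∀ n → length (filter P? (map suc (upTo n))) ≡ count P? n
length-filter≡count P? zero    = refl
length-filter≡count P? (suc n) = begin
  length (filter P? (map suc (upTo (suc n))))
    ≡⟨ cong (length ∘ filter P? ∘ map suc) (sym (upTo-∷ʳ n)) ⟩
  length (filter P? (map suc (upTo n ++ [ n ])))
    ≡⟨ cong (length ∘ filter P?) (map-++ suc (upTo n) [ n ]) ⟩
  length (filter P? (map suc (upTo n) ++ [ suc n ]))
    ≡⟨ cong length (filter-++ P? (map suc (upTo n)) [ suc n ]) ⟩
  length (filter P? (map suc (upTo n)) ++ filter P? [ suc n ])
    ≡⟨ length-++ (filter P? (map suc (upTo n))) ⟩
  length (filter P? (map suc (upTo n))) + length (filter P? [ suc n ])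
    ≡⟨ cong₂ _+_ (length-filter≡count P? n) (length-filter-[x] P? (suc n)) ⟩
  count P? (suc n) ∎
  where open ≡-Reasoning

count-cong : (P? : Decidable P) (Q? : Decidable Q) → (∀ k → P k ⇔ Q k) → ∀ n → count P? n ≡ count Q? n
count-cong P? Q? P⇔Q zero    = refl
count-cong P? Q? P⇔Q (suc n) =
  cong₂ _+_ (count-cong P? Q? P⇔Q n) (cong 𝟙 (does-⇔ (P⇔Q (suc n)) (P? (suc n)) (Q? (suc n))))

count-none : (P? : Decidable P) → ∀ n → (∀ k → 0 < k → k ≤ n → ¬ P k) → count P? n ≡ 0
count-none P? zero    _  = refl
count-none P? (suc n) ¬P = cong₂ _+_ (count-none P? n (λ k 0<k k≤n → ¬P k 0<k (m≤n⇒m≤1+n k≤n)))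
                                     (cong 𝟙 (dec-false (P? (suc n)) (¬P (suc n) z<s ≤-refl)))

count-+ : (P? : Decidable P) → ∀ m n → count P? (m + n) ≡ count P? m + count (λ k → P? (m + k)) n
count-+ P? m zero    rewrite +-identityʳ m = sym (+-identityʳ _)
count-+ P? m (suc n) rewrite +-suc m n | count-+ P? m n = +-assoc (count P? m) _ _

count-periodic : (P? : Decidable P) → ∀ n → (∀ k → P (n + k) ⇔ P k) → ∀ t → count P? (t * n) ≡ t * count P? n
count-periodic P? n periodic zero    = refl
count-periodic P? n periodic (suc t) = begin
  count P? (n + t * n)                           ≡⟨ count-+ P? n (t * n) ⟩
  count P? n + count (λ k → P? (n + k)) (t * n)  ≡⟨ cong (count P? n +_) (count-cong _ P? periodic (t * n)) ⟩
  count P? n + count P? (t * n)                  ≡⟨ cong (count P? n +_) (count-periodic P? n periodic t) ⟩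
  count P? n + t * count P? n                    ∎
  where open ≡-Reasoning

count-split : (P? : Decidable P) (Q? : Decidable Q) → ∀ n →
              count P? n ≡ count (P? ∩? Q?) n + count (P? ∩? ∁? Q?) n
count-split P? Q? zero    = refl
count-split P? Q? (suc n) = begin
  count P? n + 𝟙 (does (P? (suc n)))
    ≡⟨ cong₂ _+_ (count-split P? Q? n) (𝟙-split (does (P? (suc n))) (does (Q? (suc n)))) ⟩
  (count (P? ∩? Q?) n + count (P? ∩? ∁? Q?) n) + (𝟙 (does ((P? ∩? Q?) (suc n))) + 𝟙 (does ((P? ∩? ∁? Q?) (suc n))))
    ≡⟨ +-interchange (count (P? ∩? Q?) n) _ _ _ ⟩
  count (P? ∩? Q?) (suc n) + count (P? ∩? ∁? Q?) (suc n) ∎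
  where
  open ≡-Reasoning
  𝟙-split : ∀ a b → 𝟙 a ≡ 𝟙 (a ∧ b) + 𝟙 (a ∧ not b)
  𝟙-split true  true  = refl
  𝟙-split true  false = refl
  𝟙-split false _     = refl

count-multiples : (P? : Decidable P) → ∀ p .{{_ : NonZero p}} n →
                  count (P? ∩? (p ∣?_)) (p * n) ≡ count (λ j → P? (p * j)) n
count-multiples P? p zero    rewrite *-zeroʳ p = refl
count-multiples P? p@(suc q) (suc n) = begin
  count M (p * suc n)                                   ≡⟨ cong (count M) pn+p≡p[1+n] ⟨
  count M (p * n + p)                                   ≡⟨ count-+ M (p * n) p ⟩
  count M (p * n) + count (λ i → M (p * n + i)) p       ≡⟨ cong₂ _+_ (count-multiples P? p n) last-block ⟩
  count (λ j → P? (p * j)) n + 𝟙 (does (P? (p * n + p))) ≡⟨ cong (λ x → count (λ j → P? (p * j)) n + 𝟙 (does (P? x))) pn+p≡p[1+n] ⟩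
  count (λ j → P? (p * j)) (suc n)                      ∎
  where
  open ≡-Reasoning
  M = P? ∩? (p ∣?_)
  pn+p≡p[1+n] : p * n + p ≡ p * suc n
  pn+p≡p[1+n] = trans (+-comm (p * n) p) (sym (*-suc p n))
  p∤pn+i : ∀ i → 0 < i → i ≤ q → ¬ p ∣ p * n + i
  p∤pn+i i 0<i i≤q p∣pn+i = <⇒≱ (s≤s i≤q) (∣⇒≤ ⦃ >-nonZero 0<i ⦄ (∣m+n∣m⇒∣n p∣pn+i (m∣m*n n)))
  last-block : count (λ i → M (p * n + i)) p ≡ 𝟙 (does (P? (p * n + p)))
  last-block = begin
    count (λ i → M (p * n + i)) q + 𝟙 (does (M (p * n + p)))
      ≡⟨ cong (_+ 𝟙 (does (M (p * n + p)))) (count-none _ q (λ i 0<i i≤q → p∤pn+i i 0<i i≤q ∘ proj₂)) ⟩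
    𝟙 (does (P? (p * n + p)) ∧ does (p ∣? (p * n + p)))
      ≡⟨ cong (λ b → 𝟙 (does (P? (p * n + p)) ∧ b)) (dec-true (p ∣? (p * n + p)) (∣m∣n⇒∣m+n (m∣m*n n) ∣-refl)) ⟩
    𝟙 (does (P? (p * n + p)) ∧ true)
      ≡⟨ cong 𝟙 (∧-identityʳ _) ⟩
    𝟙 (does (P? (p * n + p)))                                ∎

φ≡count : ∀ n → φ n ≡ count (λ k → coprime? k n) n
φ≡count n = trans (length-filter≡count (λ k → gcd k n ≟ 1) n)
                  (count-cong _ _ (λ k → mk⇔ gcd≡1⇒coprime coprime⇒gcd≡1) n)

coprime-* : ∀ {k m n} → Coprime k m → Coprime k n → Coprime k (m * n)
coprime-* k⊥m k⊥n (d∣k , d∣mn) = k⊥n (d∣k , coprime-divisor d⊥m d∣mn)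
  where
  d⊥m : Coprime _ _
  d⊥m (e∣d , e∣m) = k⊥m (∣-trans e∣d d∣k , e∣m)

prime∤⇒coprime : ∀ {p k} → Prime p → ¬ p ∣ k → Coprime p k
prime∤⇒coprime pr p∤k (d∣p , d∣k) with prime⇒irreducible pr d∣p
... | inj₁ d≡1 = d≡1
... | inj₂ refl = contradiction d∣k p∤k

prime∣⇒¬coprime : ∀ {p k n} → Prime p → p ∣ k → p ∣ n → ¬ Coprime k n
prime∣⇒¬coprime pr p∣k p∣n k⊥n = ¬prime[1] (subst Prime (k⊥n (p∣k , p∣n)) pr)

coprime[n+k,n]⇔coprime[k,n] : ∀ n k → Coprime (n + k) n ⇔ Coprime k n
coprime[n+k,n]⇔coprime[k,n] n k =
  mk⇔ (λ (n+k⊥n : Coprime (n + k) n) {_} (d∣k , d∣n) → n+k⊥n (∣m∣n⇒∣m+n d∣n d∣k , d∣n)) coprime-+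

coprime[k,p*n]⇔coprime[k,n]×p∤k : ∀ {p} → Prime p → ∀ n k → Coprime k (p * n) ⇔ (Coprime k n × ¬ p ∣ k)
coprime[k,p*n]⇔coprime[k,n]×p∤k {p} pr n k = mk⇔
  (λ (k⊥pn : Coprime k (p * n)) → (λ {_} (d∣k , d∣n) → k⊥pn (d∣k , ∣-trans d∣n (n∣m*n p)))
          , (λ p∣k → prime∣⇒¬coprime pr p∣k (m∣m*n n) k⊥pn))
  (λ (k⊥n , p∤k) → coprime-* (coprime-sym (prime∤⇒coprime pr p∤k)) k⊥n)

coprime[p*j,n]⇔coprime[j,n] : ∀ {p n} → Prime p → ¬ p ∣ n → ∀ j → Coprime (p * j) n ⇔ Coprime j n
coprime[p*j,n]⇔coprime[j,n] {p} {n} pr p∤n j = mk⇔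
  (λ (pj⊥n : Coprime (p * j) n) {_} (d∣j , d∣n) → pj⊥n (∣-trans d∣j (n∣m*n p) , d∣n))
  (λ j⊥n → coprime-sym (coprime-* (coprime-sym (prime∤⇒coprime pr p∤n)) (coprime-sym j⊥n)))

p*φ[n]≡count+φ[p*n] : ∀ {p} → Prime p → ∀ n → p * φ n ≡ count (λ j → coprime? (p * j) n) n + φ (p * n)
p*φ[n]≡count+φ[p*n] {p} pr n = begin
  p * φ n                                   ≡⟨ cong (p *_) (φ≡count n) ⟩
  p * count C n                             ≡⟨ count-periodic C n (coprime[n+k,n]⇔coprime[k,n] n) p ⟨
  count C (p * n)                           ≡⟨ count-split C (p ∣?_) (p * n) ⟩
  count (C ∩? (p ∣?_)) (p * n) + count (C ∩? ∁? (p ∣?_)) (p * n)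
    ≡⟨ cong₂ _+_ (count-multiples C p ⦃ prime⇒nonZero pr ⦄ n)
                 (count-cong _ _ (λ k → ⇔-sym (coprime[k,p*n]⇔coprime[k,n]×p∤k pr n k)) (p * n)) ⟩
  count (λ j → coprime? (p * j) n) n + count (λ k → coprime? k (p * n)) (p * n)
    ≡⟨ cong (count (λ j → coprime? (p * j) n) n +_) (φ≡count (p * n)) ⟨
  count (λ j → coprime? (p * j) n) n + φ (p * n) ∎
  where
  open ≡-Reasoning
  C = λ k → coprime? k n

φ[p*n]≡p*φ[n] : ∀ {p} → Prime p → ∀ {n} → p ∣ n → φ (p * n) ≡ p * φ n
φ[p*n]≡p*φ[n] {p} pr {n} p∣n = sym (begin
  p * φ n                                             ≡⟨ p*φ[n]≡count+φ[p*n] pr n ⟩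
  count (λ j → coprime? (p * j) n) n + φ (p * n)      ≡⟨ cong (_+ φ (p * n)) no-multiple-coprime ⟩
  φ (p * n)                                           ∎)
  where
  open ≡-Reasoning
  no-multiple-coprime : count (λ j → coprime? (p * j) n) n ≡ 0
  no-multiple-coprime = count-none _ n (λ j _ _ → prime∣⇒¬coprime pr (m∣m*n j) p∣n)

φ[n]+φ[p*n]≡p*φ[n] : ∀ {p} → Prime p → ∀ {n} → ¬ p ∣ n → φ n + φ (p * n) ≡ p * φ n
φ[n]+φ[p*n]≡p*φ[n] {p} pr {n} p∤n = sym (begin
  p * φ n                                             ≡⟨ p*φ[n]≡count+φ[p*n] pr n ⟩
  count (λ j → coprime? (p * j) n) n + φ (p * n)      ≡⟨ cong (_+ φ (p * n)) multiples-coprime ⟩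
  φ n + φ (p * n)                                     ∎)
  where
  open ≡-Reasoning
  multiples-coprime : count (λ j → coprime? (p * j) n) n ≡ φ n
  multiples-coprime = trans (count-cong _ _ (coprime[p*j,n]⇔coprime[j,n] pr p∤n) n) (sym (φ≡count n))

p*φ[n]≤φ[n]+φ[p*n] : ∀ {p} → Prime p → ∀ n → p * φ n ≤ φ n + φ (p * n)
p*φ[n]≤φ[n]+φ[p*n] {p} pr n with p ∣? n
... | yes p∣n = ≤-trans (≤-reflexive (sym (φ[p*n]≡p*φ[n] pr p∣n))) (m≤n+m _ _)
... | no p∤n  = ≤-reflexive (sym (φ[n]+φ[p*n]≡p*φ[n] pr p∤n))

prime[3] : Prime 3
prime[3] = from-yes (prime? 3)

φ[2*n]≡φ[n] : ∀ {n} → ¬ 2 ∣ n → φ (2 * n) ≡ φ n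
φ[2*n]≡φ[n] {n} 2∤n = trans (+-cancelˡ-≡ (φ n) _ _ (φ[n]+φ[p*n]≡p*φ[n] prime[2] 2∤n)) (+-identityʳ (φ n))

φ[3*n]≡2*φ[n] : ∀ {n} → ¬ 3 ∣ n → φ (3 * n) ≡ 2 * φ n
φ[3*n]≡2*φ[n] {n} 3∤n = +-cancelˡ-≡ (φ n) _ _ (φ[n]+φ[p*n]≡p*φ[n] prime[3] 3∤n)

-- exponents a, b ≥ 1
data 2ᵃ3ᵇ : ℕ → Set where
  six    : 2ᵃ3ᵇ 6
  double : ∀ {y} → 2ᵃ3ᵇ y → 2ᵃ3ᵇ (2 * y)
  triple : ∀ {y} → 2ᵃ3ᵇ y → 2ᵃ3ᵇ (3 * y)

2ᵃ3ᵇ⇒2∣ : ∀ {y} → 2ᵃ3ᵇ y → 2 ∣ y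
2ᵃ3ᵇ⇒2∣ six            = divides 3 refl
2ᵃ3ᵇ⇒2∣ (double {y} _) = m∣m*n y
2ᵃ3ᵇ⇒2∣ (triple y)     = ∣-trans (2ᵃ3ᵇ⇒2∣ y) (n∣m*n 3)

2ᵃ3ᵇ⇒3∣ : ∀ {y} → 2ᵃ3ᵇ y → 3 ∣ y
2ᵃ3ᵇ⇒3∣ six            = divides 2 refl
2ᵃ3ᵇ⇒3∣ (double y)     = ∣-trans (2ᵃ3ᵇ⇒3∣ y) (n∣m*n 2)
2ᵃ3ᵇ⇒3∣ (triple {y} _) = m∣m*n y

3*φ[y*s]≡y*φ[s] : ∀ {s} → ¬ 2 ∣ s → ¬ 3 ∣ s → ∀ {y} → 2ᵃ3ᵇ y → 3 * φ (y * s) ≡ y * φ s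
3*φ[y*s]≡y*φ[s] {s} 2∤s 3∤s six = begin
  3 * φ (6 * s)        ≡⟨ cong (λ x → 3 * φ x) (*-assoc 2 3 s) ⟩
  3 * φ (2 * (3 * s))  ≡⟨ cong (3 *_) (φ[2*n]≡φ[n] 2∤3s) ⟩
  3 * φ (3 * s)        ≡⟨ cong (3 *_) (φ[3*n]≡2*φ[n] 3∤s) ⟩
  3 * (2 * φ s)        ≡⟨ *-assoc 3 2 (φ s) ⟨
  6 * φ s              ∎
  where
  open ≡-Reasoning
  2∤3s : ¬ 2 ∣ 3 * s
  2∤3s 2∣3s with euclidsLemma 3 s prime[2] 2∣3s
  ... | inj₁ 2∣3 = from-no (2 ∣? 3) 2∣3
  ... | inj₂ 2∣s = 2∤s 2∣s
3*φ[y*s]≡y*φ[s] {s} 2∤s 3∤s (double {y} y∈) = begin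
  3 * φ (2 * y * s)    ≡⟨ cong (λ x → 3 * φ x) (*-assoc 2 y s) ⟩
  3 * φ (2 * (y * s))  ≡⟨ cong (3 *_) (φ[p*n]≡p*φ[n] prime[2] (∣-trans (2ᵃ3ᵇ⇒2∣ y∈) (m∣m*n s))) ⟩
  3 * (2 * φ (y * s))  ≡⟨ x*[y*z]≡y*[x*z] 3 2 (φ (y * s)) ⟩
  2 * (3 * φ (y * s))  ≡⟨ cong (2 *_) (3*φ[y*s]≡y*φ[s] 2∤s 3∤s y∈) ⟩
  2 * (y * φ s)        ≡⟨ *-assoc 2 y (φ s) ⟨
  2 * y * φ s          ∎
  where open ≡-Reasoning
3*φ[y*s]≡y*φ[s] {s} 2∤s 3∤s (triple {y} y∈) = begin
  3 * φ (3 * y * s)    ≡⟨ cong (λ x → 3 * φ x) (*-assoc 3 y s) ⟩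
  3 * φ (3 * (y * s))  ≡⟨ cong (3 *_) (φ[p*n]≡p*φ[n] prime[3] (∣-trans (2ᵃ3ᵇ⇒3∣ y∈) (m∣m*n s))) ⟩
  3 * (3 * φ (y * s))  ≡⟨ cong (3 *_) (3*φ[y*s]≡y*φ[s] 2∤s 3∤s y∈) ⟩
  3 * (y * φ s)        ≡⟨ *-assoc 3 y (φ s) ⟨
  3 * y * φ s          ∎
  where open ≡-Reasoning

Bracket : ℕ → Set
Bracket p = ∃[ y ] 2ᵃ3ᵇ y × 2 * p < y × 3 + y ≤ 3 * p

bracket-window : ∀ {y p} c k → 2ᵃ3ᵇ y → y ≡ 2 * c → y ≡ 3 * k → k < p → p < c → Bracket p
bracket-window {p = p} c k y∈ refl 2c≡3k k<p p<c = 2 * c , y∈ , *-monoʳ-< 2 p<c , (begin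
  3 + 2 * c  ≡⟨ cong (3 +_) 2c≡3k ⟩
  3 + 3 * k  ≡⟨ *-suc 3 k ⟨
  3 * suc k  ≤⟨ *-monoʳ-≤ 3 k<p ⟩
  3 * p      ∎)
  where open ≤-Reasoning

bracket-small : ∀ {p} → 5 ≤ p → p < 27 → p ≢ 6 → p ≢ 12 → Bracket p
bracket-small {p} 5≤p p<27 p≢6 p≢12 with p <? 6
... | yes p<6 = bracket-window 6 4 (double six) refl refl 5≤p p<6
... | no p≮6 with p <? 9
...   | yes p<9 = bracket-window 9 6 (triple six) refl refl (≤∧≢⇒< (≮⇒≥ p≮6) (p≢6 ∘ sym)) p<9
...   | no p≮9 with p <? 12
...     | yes p<12 = bracket-window 12 8 (double (double six)) refl refl (≮⇒≥ p≮9) p<12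
...     | no p≮12 with p <? 18
...       | yes p<18 = bracket-window 18 12 (double (triple six)) refl refl (≤∧≢⇒< (≮⇒≥ p≮12) (p≢12 ∘ sym)) p<18
...       | no p≮18 with p <? 24
...         | yes p<24 = bracket-window 24 16 (double (double (double six))) refl refl (<⇒≤ (≮⇒≥ p≮18)) p<24
...         | no p≮24 = bracket-window 27 18 (triple (triple six)) refl refl (≤-trans (m≤n+m 19 5) (≮⇒≥ p≮24)) p<27

2∣∧2h<⇒1+2h< : ∀ {h y} → 2 ∣ y → 2 * h < y → suc (2 * h) < y
2∣∧2h<⇒1+2h< {h} (divides c refl) 2h<2c = begin-strict
  suc (2 * h)        <⟨ n<1+n _ ⟩
  suc (suc (2 * h))  ≡⟨ *-suc 2 h ⟨
  2 * suc h          ≤⟨ *-monoʳ-≤ 2 (*-cancelʳ-< 2 h c (subst (_< c * 2) (*-comm 2 h) 2h<2c)) ⟩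
  2 * c              ≡⟨ *-comm 2 c ⟩
  c * 2              ∎
  where open ≤-Reasoning

bracket-double : ∀ {h p} → 2 * h ≤ p → p ≤ suc (2 * h) → Bracket h → Bracket p
bracket-double {h} {p} 2h≤p p≤1+2h (y , y∈ , 2h<y , 3+y≤3h) =
  2 * y , double y∈ , *-monoʳ-< 2 (≤-<-trans p≤1+2h (2∣∧2h<⇒1+2h< {h} (2ᵃ3ᵇ⇒2∣ y∈) 2h<y)) , (begin
    3 + 2 * y    ≤⟨ +-monoˡ-≤ (2 * y) (m≤n+m 3 3) ⟩
    6 + 2 * y    ≡⟨ *-distribˡ-+ 2 3 y ⟨
    2 * (3 + y)  ≤⟨ *-monoʳ-≤ 2 3+y≤3h ⟩
    2 * (3 * h)  ≡⟨ x*[y*z]≡y*[x*z] 2 3 h ⟩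
    3 * (2 * h)  ≤⟨ *-monoʳ-≤ 3 2h≤p ⟩
    3 * p        ∎)
  where open ≤-Reasoning

2*⌊n/2⌋≤n : ∀ n → 2 * ⌊ n /2⌋ ≤ n
2*⌊n/2⌋≤n 0             = z≤n
2*⌊n/2⌋≤n 1             = z≤n
2*⌊n/2⌋≤n (suc (suc n)) = subst (_≤ 2 + n) (sym (*-suc 2 ⌊ n /2⌋)) (s≤s (s≤s (2*⌊n/2⌋≤n n)))

n≤1+2*⌊n/2⌋ : ∀ n → n ≤ suc (2 * ⌊ n /2⌋)
n≤1+2*⌊n/2⌋ 0             = z≤n
n≤1+2*⌊n/2⌋ 1             = ≤-refl
n≤1+2*⌊n/2⌋ (suc (suc n)) = subst (2 + n ≤_) (cong suc (sym (*-suc 2 ⌊ n /2⌋))) (s≤s (s≤s (n≤1+2*⌊n/2⌋ n)))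

bracket : ∀ p → 5 ≤ p → p ≢ 6 → p ≢ 12 → Bracket p
bracket = <-rec _ step
  where
  step : ∀ p → (∀ {h} → h < p → 5 ≤ h → h ≢ 6 → h ≢ 12 → Bracket h) → 5 ≤ p → p ≢ 6 → p ≢ 12 → Bracket p
  step zero    _   ()
  step (suc p) rec 5≤p p≢6 p≢12 with suc p <? 27
  ... | yes p<27 = bracket-small 5≤p p<27 p≢6 p≢12
  ... | no p≮27  = bracket-double {⌊ suc p /2⌋} (2*⌊n/2⌋≤n (suc p)) (n≤1+2*⌊n/2⌋ (suc p))
                     (rec (⌊n/2⌋<n p) (≤-trans (m≤n+m 5 8) 13≤h) (>⇒≢ (≤-trans (m≤n+m 7 6) 13≤h)) (>⇒≢ 13≤h))
    where
    13≤h : 13 ≤ ⌊ suc p /2⌋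
    13≤h = ⌊n/2⌋-mono (≮⇒≥ p≮27)

prime∤6⇒5≤ : ∀ {p} → Prime p → ¬ 2 ∣ p → ¬ 3 ∣ p → 5 ≤ p
prime∤6⇒5≤ {0} pr _   _   = contradiction pr ¬prime[0]
prime∤6⇒5≤ {1} pr _   _   = contradiction pr ¬prime[1]
prime∤6⇒5≤ {2} _  2∤2 _   = contradiction ∣-refl 2∤2
prime∤6⇒5≤ {3} _  _   3∤3 = contradiction ∣-refl 3∤3
prime∤6⇒5≤ {4} _  2∤4 _   = contradiction (divides 2 refl) 2∤4
prime∤6⇒5≤ {suc (suc (suc (suc (suc _))))} _ _ _ = s≤s (s≤s (s≤s (s≤s (s≤s z≤n))))

bracket-prime : ∀ {p} → Prime p → ¬ 2 ∣ p → ¬ 3 ∣ p → Bracket p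
bracket-prime {p} pr 2∤p 3∤p = bracket p (prime∤6⇒5≤ pr 2∤p 3∤p)
  (λ { refl → 2∤p (divides 3 refl) }) (λ { refl → 2∤p (divides 6 refl) })

φ[y*s]≤φ[p*s] : ∀ {p s y} → Prime p → ¬ 2 ∣ s → ¬ 3 ∣ s → 2ᵃ3ᵇ y → 3 + y ≤ 3 * p → φ (y * s) ≤ φ (p * s)
φ[y*s]≤φ[p*s] {p} {s} {y} pr 2∤s 3∤s y∈ 3+y≤3p = *-cancelˡ-≤ 3 (+-cancelʳ-≤ (3 * φ s) _ _ (begin
  3 * φ (y * s) + 3 * φ s  ≡⟨ cong (_+ 3 * φ s) (3*φ[y*s]≡y*φ[s] 2∤s 3∤s y∈) ⟩
  y * φ s + 3 * φ s        ≡⟨ *-distribʳ-+ (φ s) y 3 ⟨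
  (y + 3) * φ s            ≤⟨ *-monoˡ-≤ (φ s) (≤-trans (≤-reflexive (+-comm y 3)) 3+y≤3p) ⟩
  3 * p * φ s              ≡⟨ *-assoc 3 p (φ s) ⟩
  3 * (p * φ s)            ≤⟨ *-monoʳ-≤ 3 (p*φ[n]≤φ[n]+φ[p*n] pr s) ⟩
  3 * (φ s + φ (p * s))    ≡⟨ *-distribˡ-+ 3 (φ s) (φ (p * s)) ⟩
  3 * φ s + 3 * φ (p * s)  ≡⟨ +-comm (3 * φ s) _ ⟩
  3 * φ (p * s) + 3 * φ s  ∎))
  where open ≤-Reasoning

Surpassed : ℕ → Set
Surpassed N = ∃[ x ] N < x × φ x ≤ φ N

IsN₁⇒¬Surpassed : ∀ {m N} → IsN₁ m N → ¬ Surpassed N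
IsN₁⇒¬Surpassed (_ , φN≤m , maximal) (x , N<x , φx≤φN) =
  <⇒≱ N<x (maximal x (≤-trans (s≤s z≤n) N<x) (≤-trans φx≤φN φN≤m))

prime-factor : ∀ n .{{_ : NonZero n}} → n ≢ 1 → ∃[ p ] ∃[ s ] Prime p × n ≡ p * s
prime-factor n n≢1 with factorise n
... | record { factors = [] ; isFactorisation = n≡1 } = contradiction n≡1 n≢1
... | record { factors = p ∷ ps ; isFactorisation = n≡p*s ; factorsPrime = pr ∷ _ } = p , product ps , pr , n≡p*s

surpassed-2*[p*s] : ∀ {p s} → Prime p → 1 ≤ s → ¬ 2 ∣ p * s → ¬ 3 ∣ p * s → Surpassed (2 * (p * s))
surpassed-2*[p*s] {p} {s} pr 1≤s 2∤ps 3∤ps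
  with y , y∈ , 2p<y , 3+y≤3p ← bracket-prime pr (2∤ps ∘ flip ∣-trans (m∣m*n s)) (3∤ps ∘ flip ∣-trans (m∣m*n s)) =
  y * s , 2ps<ys , (begin
    φ (y * s)        ≤⟨ φ[y*s]≤φ[p*s] pr (2∤ps ∘ flip ∣-trans (n∣m*n p)) (3∤ps ∘ flip ∣-trans (n∣m*n p)) y∈ 3+y≤3p ⟩
    φ (p * s)        ≡⟨ φ[2*n]≡φ[n] 2∤ps ⟨
    φ (2 * (p * s))  ∎)
  where
  open ≤-Reasoning
  2ps<ys : 2 * (p * s) < y * s
  2ps<ys = subst (_< y * s) (*-assoc 2 p s) (*-monoˡ-< s ⦃ >-nonZero 1≤s ⦄ 2p<y)

surpassed-2* : ∀ {k} → 1 ≤ k → ¬ 3 ∣ k → k ≢ 1 → Surpassed (2 * k)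
surpassed-2* {k} 1≤k 3∤k k≢1 with 2 ∣? k
... | yes 2∣k = 3 * k , *-monoˡ-< k ⦃ >-nonZero 1≤k ⦄ (n<1+n 2) , ≤-reflexive (begin
  φ (3 * k)  ≡⟨ φ[3*n]≡2*φ[n] 3∤k ⟩
  2 * φ k    ≡⟨ φ[p*n]≡p*φ[n] prime[2] 2∣k ⟨
  φ (2 * k)  ∎)
  where open ≡-Reasoning
... | no 2∤k with p , s , pr , refl ← prime-factor k ⦃ >-nonZero 1≤k ⦄ k≢1 =
  surpassed-2*[p*s] pr (>-nonZero⁻¹ s ⦃ m*n≢0⇒n≢0 p ⦃ >-nonZero 1≤k ⦄ ⦄) 2∤k 3∤k

surpassed : ∀ {N} → 1 ≤ N → ¬ 3 ∣ N → N ≢ 2 → Surpassed N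
surpassed {N} 1≤N 3∤N N≢2 with 2 ∣? N
... | no 2∤N = 2 * N , N<2N , ≤-reflexive (φ[2*n]≡φ[n] 2∤N)
  where
  N<2N : N < 2 * N
  N<2N = subst (_< 2 * N) (*-identityˡ N) (*-monoˡ-< N ⦃ >-nonZero 1≤N ⦄ (n<1+n 1))
... | yes (divides k refl) =
  subst Surpassed (*-comm 2 k) (surpassed-2* 1≤k (3∤N ∘ flip ∣-trans (m∣m*n 2)) (N≢2 ∘ cong (_* 2)))
  where
  1≤k : 1 ≤ k
  1≤k = >-nonZero⁻¹ k ⦃ m*n≢0⇒m≢0 k ⦃ >-nonZero 1≤N ⦄ ⦄

corollary1 : ∀ (m N : ℕ) → InV m → 1 < m → IsN₁ m N → 3 ∣ N
corollary1 m N _ 1<m N₁@(1≤N , _ , maximal) with 3 ∣? N | N ≟ 2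
... | yes 3∣N | _        = 3∣N
... | no _    | yes refl = contradiction (maximal 6 z<s 1<m) (from-no (6 ≤? 2))
... | no 3∤N  | no N≢2   = contradiction (surpassed 1≤N 3∤N N≢2) (IsN₁⇒¬Surpassed N₁)
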